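{- $\mathbf{K_N^{Horn,\Diamond}}$ is closed under product of models: if $\varphi$ is a $\mathbf{K_N^{Horn,\Diamond}}$-formula, $M_1=(\mathcal F_1,V_1)$ and $M_2=(\mathcal F_2,V_2)$ are models with worlds $w_1$ of $M_1$ and $w_2$ of $M_2$ such that $M_1,w_1\Vdash\varphi$ and $M_2,w_2\Vdash\varphi$, then $M_{M_1\times M_2},(w_1,w_2)\Vdash\varphi$.
   Context: Fix a finite set $\tau$ of modality labels and a countable set $\mathcal P$ of propositional letters. Formulas of $\mathbf{K_N}$ are generated by $\varphi ::= \top \mid p \mid \neg\varphi \mid \varphi\vee\varphi \mid \Diamond_\alpha\varphi \mid \Box_\alpha\varphi$; $\wedge,\rightarrow$ are abbreviations, $\bot=\neg\top$. A frame $\mathcal F=(W,\{R_\alpha\}_{\alpha\in\tau})$ has $W\ne\emptyset$ and $R_\alpha\subseteq W\times W$; a model $(\mathcal F,V)$ adds $V:W\to2^{\mathcal P}$, with standard Kripke semantics. Positive literals: $\lambda ::= \top \mid p \mid \Diamond_\alpha\lambda \mid \Box_\alpha\lambda$. Clausal form: $\varphi ::= \lambda \mid \neg\lambda \mid \nabla(\neg\lambda_1\vee\dots\vee\neg\lambda_n\vee\lambda_{n+1}\vee\dots\vee\lambda_{n+m}) \mid \varphi\wedge\varphi$, with positive literals $\lambda,\lambda_i$ and $\nabla$ a finite (possibly empty) sequence of boxes. $\mathbf{K_N^{Horn}}$: every clause has $m\le1$. $\mathbf{K_N^{Horn,\Diamond}}$ is the subfragment of $\mathbf{K_N^{Horn}}$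 in which positive literals contain no boxes ($\lambda::=\top\mid p\mid\Diamond_\alpha\lambda$; box prefixes $\nabla$ are still allowed). Given $M_1=((W_1,\{R_{1,\alpha}\}),V_1)$ and $M_2=((W_2,\{R_{2,\alpha}\}),V_2)$, the product model $M_{M_1\times M_2}$ has worlds $W_1\times W_2$, relations $(w_1,w_2)R_\alpha(w_1',w_2')$ iff $w_1R_{1,\alpha}w_1'$ and $w_2R_{2,\alpha}w_2'$, and valuation $V((w_1,w_2))=V_1(w_1)\cap V_2(w_2)$. -}

module Defs where

open import Data.Nat using (ℕ)
open import Data.Fin using (Fin)
open import Data.Product using (_×_; _,_; Σ)
open import Data.Sum using (_⊎_)
open import Data.Unit using (⊤)
open import Data.Empty using (⊥)
open import Relation.Nullary using (¬_)
open import Level using (Level; suc; _⊔_)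

module _ (k : ℕ) where

  Label : Set
  Label = Fin k

  data Formula : Set where
    ⊤f  : Formula
    var : ℕ → Formula
    ¬f  : Formula → Formula
    _∨f_ : Formula → Formula → Formula
    ◇   : Label → Formula → Formula
    □   : Label → Formula → Formula

  _∧f_ : Formula → Formula → Formula
  φ ∧f ψ = ¬f ((¬f φ) ∨f (¬f ψ))

  -- Kripke models (worlds in an arbitrary type; a model's W is nonempty
  -- whenever a world is given, as in the statement)
  record Model (ℓ : Level) : Set (suc ℓ) where
    field
      W : Set ℓ
      R : Label → W → W → Set ℓ
      V : W → ℕ → Set ℓ

  open Model

  _,_⊩_ : ∀ {ℓ} (M : Model ℓ) → W M → Formula → Set ℓ
  M , w ⊩ ⊤f = Level.Lift _ ⊤
  M , w ⊩ var p = V M w p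
  M , w ⊩ ¬f φ = ¬ (M , w ⊩ φ)
  M , w ⊩ (φ ∨f ψ) = (M , w ⊩ φ) ⊎ (M , w ⊩ ψ)
  M , w ⊩ ◇ a φ = Σ (W M) λ v → R M a w v × (M , v ⊩ φ)
  M , w ⊩ □ a φ = ∀ v → R M a w v → M , v ⊩ φ

  _⊗_ : ∀ {ℓ} → Model ℓ → Model ℓ → Model ℓ
  M₁ ⊗ M₂ = record
    { W = W M₁ × W M₂
    ; R = λ a x y → R M₁ a (Data.Product.proj₁ x) (Data.Product.proj₁ y)
                  × R M₂ a (Data.Product.proj₂ x) (Data.Product.proj₂ y)
    ; V = λ x p → V M₁ (Data.Product.proj₁ x) p × V M₂ (Data.Product.proj₂ x) p
    }

  data PosLit◇ : Formula → Set where
    ⊤l : PosLit◇ ⊤f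
    pl : ∀ p → PosLit◇ (var p)
    ◇l : ∀ a {φ} → PosLit◇ φ → PosLit◇ (◇ a φ)

  data NegDisj : Formula → Set where
    one  : ∀ {l} → PosLit◇ l → NegDisj (¬f l)
    more : ∀ {l φ} → PosLit◇ l → NegDisj φ → NegDisj (¬f l ∨f φ)

  data HornDisj : Formula → Set where
    neg  : ∀ {φ} → NegDisj φ → HornDisj φ
    pos  : ∀ {l} → PosLit◇ l → HornDisj l
    negpos : ∀ {l φ} → PosLit◇ l → HornDisj φ → HornDisj (¬f l ∨f φ)

  data HornClause : Formula → Set where
    base : ∀ {φ} → HornDisj φ → HornClause φ
    box  : ∀ a {φ} → HornClause φ → HornClause (□ a φ)

  data Horn◇ : Formula → Set where
    lit    : ∀ {l} → PosLit◇ l → Horn◇ l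
    neglit : ∀ {l} → PosLit◇ l → Horn◇ (¬f l)
    clause : ∀ {φ} → HornClause φ → Horn◇ φ
    conj   : ∀ {φ ψ} → Horn◇ φ → Horn◇ ψ → Horn◇ (φ ∧f ψ)

-- A box-free positive literal holds at (w₁ , w₂) exactly when it holds at w₁ and at w₂:
-- a ◇-path in the product is a pair of ◇-paths. So positive literals are preserved and
-- reflected by products, negated literals are preserved because their atoms are reflected,
-- and a Horn clause, having at most one positive disjunct, is preserved by a case split in
-- which a negated disjunct true in either factor already settles the product.
-- Boxes and conjunctions then pass preservation through.
module Submission where

open import Defs
open import Data.Nat using (ℕ)
open import Level using (Level; suc)
open import Data.Product using (_×_; _,_; proj₁; proj₂)
open import Data.Sum using (inj₁; inj₂)
open import Relation.Nullary using (¬_)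
open Model

module ProductClosure (k : ℕ) (ℓ : Level) where

  infix 4 _,_⊨_

  _,_⊨_ : (M : Model k ℓ) → W M → Formula k → Set ℓ
  M , w ⊨ φ = _,_⊩_ k M w φ

  record Preserved (φ : Formula k) : Set (suc ℓ) where
    field
      preserve : (M₁ M₂ : Model k ℓ) (w₁ : W M₁) (w₂ : W M₂) →
                 M₁ , w₁ ⊨ φ → M₂ , w₂ ⊨ φ → _⊗_ k M₁ M₂ , (w₁ , w₂) ⊨ φ

  record Reflected (φ : Formula k) : Set (suc ℓ) where
    field
      reflect : (M₁ M₂ : Model k ℓ) (w₁ : W M₁) (w₂ : W M₂) →
                _⊗_ k M₁ M₂ , (w₁ , w₂) ⊨ φ → (M₁ , w₁ ⊨ φ) × (M₂ , w₂ ⊨ φ)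

  open Preserved
  open Reflected

  PosLit◇⇒preserved : ∀ {φ} → PosLit◇ k φ → Preserved φ
  preserve (PosLit◇⇒preserved ⊤l)       M₁ M₂ w₁ w₂ h₁ h₂ = h₁
  preserve (PosLit◇⇒preserved (pl p))   M₁ M₂ w₁ w₂ h₁ h₂ = h₁ , h₂
  preserve (PosLit◇⇒preserved (◇l a l)) M₁ M₂ w₁ w₂ (v₁ , r₁ , h₁) (v₂ , r₂ , h₂) =
    (v₁ , v₂) , (r₁ , r₂) , preserve (PosLit◇⇒preserved l) M₁ M₂ v₁ v₂ h₁ h₂

  PosLit◇⇒reflected : ∀ {φ} → PosLit◇ k φ → Reflected φ
  reflect (PosLit◇⇒reflected ⊤l)       M₁ M₂ w₁ w₂ h = h , h
  reflect (PosLit◇⇒reflected (pl p))   M₁ M₂ w₁ w₂ h = h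
  reflect (PosLit◇⇒reflected (◇l a l)) M₁ M₂ w₁ w₂ ((v₁ , v₂) , (r₁ , r₂) , h)
    with reflect (PosLit◇⇒reflected l) M₁ M₂ v₁ v₂ h
  ... | h₁ , h₂ = (v₁ , r₁ , h₁) , (v₂ , r₂ , h₂)

  module _ {φ : Formula k} (φ-reflected : Reflected φ)
           (M₁ M₂ : Model k ℓ) (w₁ : W M₁) (w₂ : W M₂) where

    ¬-transferˡ : ¬ (M₁ , w₁ ⊨ φ) → ¬ (_⊗_ k M₁ M₂ , (w₁ , w₂) ⊨ φ)
    ¬-transferˡ ¬h₁ h = ¬h₁ (proj₁ (reflect φ-reflected M₁ M₂ w₁ w₂ h))

    ¬-transferʳ : ¬ (M₂ , w₂ ⊨ φ) → ¬ (_⊗_ k M₁ M₂ , (w₁ , w₂) ⊨ φ)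
    ¬-transferʳ ¬h₂ h = ¬h₂ (proj₂ (reflect φ-reflected M₁ M₂ w₁ w₂ h))

  ¬-preserved : ∀ {φ} → Reflected φ → Preserved (¬f φ)
  preserve (¬-preserved φ-reflected) M₁ M₂ w₁ w₂ ¬h₁ _ =
    ¬-transferˡ φ-reflected M₁ M₂ w₁ w₂ ¬h₁

  ¬∨-preserved : ∀ {φ ψ} → Reflected φ → Preserved ψ → Preserved (¬f φ ∨f ψ)
  preserve (¬∨-preserved φ-reflected _) M₁ M₂ w₁ w₂ (inj₁ ¬h₁) _ =
    inj₁ (¬-transferˡ φ-reflected M₁ M₂ w₁ w₂ ¬h₁)
  preserve (¬∨-preserved φ-reflected _) M₁ M₂ w₁ w₂ (inj₂ _) (inj₁ ¬h₂) =
    inj₁ (¬-transferʳ φ-reflected M₁ M₂ w₁ w₂ ¬h₂)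
  preserve (¬∨-preserved _ ψ-preserved) M₁ M₂ w₁ w₂ (inj₂ h₁) (inj₂ h₂) =
    inj₂ (preserve ψ-preserved M₁ M₂ w₁ w₂ h₁ h₂)

  □-preserved : ∀ {φ} a → Preserved φ → Preserved (□ a φ)
  preserve (□-preserved a φ-preserved) M₁ M₂ w₁ w₂ h₁ h₂ (v₁ , v₂) (r₁ , r₂) =
    preserve φ-preserved M₁ M₂ v₁ v₂ (h₁ v₁ r₁) (h₂ v₂ r₂)

  -- φ ∧f ψ is ¬(¬φ ∨ ¬ψ), so each factor only yields ¬¬φ and ¬¬ψ; preservation is
  -- applied under these double negations.
  ∧-preserved : ∀ {φ ψ} → Preserved φ → Preserved ψ → Preserved (_∧f_ k φ ψ)
  preserve (∧-preserved φ-preserved ψ-preserved) M₁ M₂ w₁ w₂ h₁ h₂ (inj₁ ¬φ) =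
    h₁ (inj₁ λ φ₁ → h₂ (inj₁ λ φ₂ → ¬φ (preserve φ-preserved M₁ M₂ w₁ w₂ φ₁ φ₂)))
  preserve (∧-preserved φ-preserved ψ-preserved) M₁ M₂ w₁ w₂ h₁ h₂ (inj₂ ¬ψ) =
    h₁ (inj₂ λ ψ₁ → h₂ (inj₂ λ ψ₂ → ¬ψ (preserve ψ-preserved M₁ M₂ w₁ w₂ ψ₁ ψ₂)))

  NegDisj⇒preserved : ∀ {φ} → NegDisj k φ → Preserved φ
  NegDisj⇒preserved (one l)    = ¬-preserved (PosLit◇⇒reflected l)
  NegDisj⇒preserved (more l d) = ¬∨-preserved (PosLit◇⇒reflected l) (NegDisj⇒preserved d)

  HornDisj⇒preserved : ∀ {φ} → HornDisj k φ → Preserved φ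
  HornDisj⇒preserved (neg d)      = NegDisj⇒preserved d
  HornDisj⇒preserved (pos l)      = PosLit◇⇒preserved l
  HornDisj⇒preserved (negpos l d) = ¬∨-preserved (PosLit◇⇒reflected l) (HornDisj⇒preserved d)

  HornClause⇒preserved : ∀ {φ} → HornClause k φ → Preserved φ
  HornClause⇒preserved (base d)  = HornDisj⇒preserved d
  HornClause⇒preserved (box a c) = □-preserved a (HornClause⇒preserved c)

  Horn◇⇒preserved : ∀ {φ} → Horn◇ k φ → Preserved φ
  Horn◇⇒preserved (lit l)    = PosLit◇⇒preserved l
  Horn◇⇒preserved (neglit l) = ¬-preserved (PosLit◇⇒reflected l)
  Horn◇⇒preserved (clause c) = HornClause⇒preserved c
  Horn◇⇒preserved (conj f g) = ∧-preserved (Horn◇⇒preserved f) (Horn◇⇒preserved g)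

lemma2 : (k : ℕ) {ℓ : Level} (φ : Formula k) → Horn◇ k φ →
         (M₁ M₂ : Model k ℓ) (w₁ : W M₁) (w₂ : W M₂) →
         _,_⊩_ k M₁ w₁ φ → _,_⊩_ k M₂ w₂ φ →
         _,_⊩_ k (_⊗_ k M₁ M₂) (w₁ , w₂) φ
lemma2 k {ℓ} φ horn = Preserved.preserve (Horn◇⇒preserved horn)
  where open ProductClosure k ℓ
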